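{- Let $\pi$ be a permutation of $[n]$ and let $W$ be a sorting word of $\pi$. Then $W$ is a DI word of $\pi$ if and only if the following holds: for every $i\in[n]$, if no letter $\mathsf{N}$ appears in $W$ strictly between $\mathsf{N}_{\pi_i}$ and $\mathsf{C}_{\pi_i}$, then $\#_{\mathsf{E}}(W^x)=\#_{\mathsf{N}}(W^x)$, where $x$ is the position with $W(x)=\mathsf{N}_{\pi_i}$ (that is, right after this step the first stack is empty).
   Context: A permutation $\pi=\pi_1\cdots\pi_n$ of $[n]=\{1,\dots,n\}$ is processed by a machine consisting of an input (initially $\pi_1,\dots,\pi_n$, read left to right), a first stack, a second stack (in series), and an output. There are three operations: $\mathsf{E}$ moves the next input entry onto the top of the first stack; $\mathsf{N}$ pops the top entry of the first stack and pushes it onto the top of the second stack; $\mathsf{C}$ pops the top entry of the second stack and appends it to the output. A sorting word of $\pi$ is a word $W$ over $\{\mathsf{E},\mathsf{N},\mathsf{C}\}$ such that, applying its letters in order starting from $\pi$ in the input and both stacks empty, every operation is legal (acts on a nonempty input/stack) and the final output is $12\cdots n$. A DI word of $\pi$ is a sorting word such that at every stage the entries of the first stack decrease from top to bottom (top is largest) and the entries of the second stack increase from top to bottom (top is smallest). For a word $W$, $W(x)$ denotes its $x$-th letter, $W^x$ its prefix of length $x$, and $\#_L(W)$ the number of occurrences of letter $L$ in $W$. In a sorting word each value $j\in[n]$ is moved by exactly one $\mathsf{E}$, one $\mathsf{N}$ and one $\mathsf{C}$; these occurrences are denoted $\mathsf{E}_j,\mathsf{N}_j,\mathsf{C}_j$.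 -}

module Defs where

open import Data.Nat using (ℕ; zero; suc; _<_; _≤_; _∸_)
open import Data.List using (List; []; _∷_; length; map; upTo; take; lookup; filter)
open import Data.List.Relation.Unary.AllPairs using (AllPairs)
open import Data.List.Relation.Binary.Permutation.Propositional using (_↭_)
open import Data.Maybe using (Maybe; just; nothing; _>>=_)
open import Data.Product using (Σ; _×_; _,_)
open import Data.Fin using (Fin)
open import Relation.Binary.PropositionalEquality using (_≡_; _≢_)
open import Relation.Nullary using (Dec; yes; no)

data Letter : Set where
  E N C : Letter

_≟L_ : (a b : Letter) → Dec (a ≡ b)
E ≟L E = yes _≡_.refl
E ≟L N = no λ ()
E ≟L C = no λ ()
N ≟L E = no λ ()
N ≟L N = yes _≡_.refl
N ≟L C = no λ ()
C ≟L E = no λ ()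
C ≟L N = no λ ()
C ≟L C = yes _≡_.refl

Word : Set
Word = List Letter

range : ℕ → List ℕ
range n = map suc (upTo n)

-- π is a permutation of [n] (one-line notation π₁ ⋯ πₙ)
IsPerm : ℕ → List ℕ → Set
IsPerm n π = π ↭ range n

-- Configuration of the machine. Stacks are lists whose head is the top.
-- Output is stored in order of output (first output element first).
record Config : Set where
  constructor cfg
  field
    input  : List ℕ
    stack1 : List ℕ
    stack2 : List ℕ
    output : List ℕ
open Config public

snoc : List ℕ → ℕ → List ℕ
snoc []       y = y ∷ []
snoc (x ∷ xs) y = x ∷ snoc xs y

step : Letter → Config → Maybe Config
step E (cfg []       s1       s2       o) = nothing
step E (cfg (x ∷ i)  s1       s2       o) = just (cfg i (x ∷ s1) s2 o)
step N (cfg i        []       s2       o) = nothing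
step N (cfg i        (x ∷ s1) s2       o) = just (cfg i s1 (x ∷ s2) o)
step C (cfg i        s1       []       o) = nothing
step C (cfg i        s1       (x ∷ s2) o) = just (cfg i s1 s2 (snoc o x))

run : Word → Config → Maybe Config
run []      c = just c
run (L ∷ W) c = step L c >>= run W

initial : List ℕ → Config
initial π = cfg π [] [] []

stateAt : Word → List ℕ → ℕ → Maybe Config
stateAt W π k = run (take k W) (initial π)

SortingWord : ℕ → List ℕ → Word → Set
SortingWord n π W = Σ Config λ c → run W (initial π) ≡ just c × output c ≡ range n

_>_ : ℕ → ℕ → Set
a > b = b < a

-- first stack decreasing from top to bottom, second increasing from top to bottom
DIConfig : Config → Set
DIConfig c = AllPairs _>_ (stack1 c) × AllPairs _<_ (stack2 c)

DIWord : ℕ → List ℕ → Word → Set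
DIWord n π W = SortingWord n π W ×
  ((k : ℕ) → k ≤ length W → (c : Config) → stateAt W π k ≡ just c → DIConfig c)

-- W(x), 1-based; nothing outside 1 ≤ x ≤ |W|
letterAt : Word → ℕ → Maybe Letter
letterAt []      _             = nothing
letterAt (L ∷ W) zero          = nothing
letterAt (L ∷ W) (suc zero)    = just L
letterAt (L ∷ W) (suc (suc x)) = letterAt W (suc x)

head? : List ℕ → Maybe ℕ
head? []      = nothing
head? (x ∷ _) = just x

-- x is the position of N_j: W(x) = N and the entry it moves (top of the
-- first stack just before step x) is j
IsNPos : List ℕ → Word → ℕ → ℕ → Set
IsNPos π W j x = letterAt W x ≡ just N ×
  (stateAt W π (x ∸ 1) >>= λ c → head? (stack1 c)) ≡ just j

-- y is the position of C_j: W(y) = C and it moves j (top of second stack before step y)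
IsCPos : List ℕ → Word → ℕ → ℕ → Set
IsCPos π W j y = letterAt W y ≡ just C ×
  (stateAt W π (y ∸ 1) >>= λ c → head? (stack2 c)) ≡ just j

count : Letter → Word → ℕ
count L W = length (filter (λ M → M ≟L L) W)

Condition : List ℕ → Word → Set
Condition π W = (i : Fin (length π)) → (x y : ℕ) →
  IsNPos π W (lookup π i) x → IsCPos π W (lookup π i) y →
  ((z : ℕ) → x < z → z < y → letterAt W z ≢ just N) →
  count E (take x W) ≡ count N (take x W)

module Submission where

-- Along a run that finishes with sorted output, an invariant propagated backwards from the end
-- (Good) says that the output followed by the second stack is increasing and that everything
-- already output is smaller than everything in the first stack or the input.  Hence the second
-- stack is always increasing, and only the first stack needs an argument.
--   (⇒) If N_j leaves some k below it and no N precedes C_j, then k < j since the first stack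
--       decreases, but k is still in the first stack when j is output, so j < k.
--   (⇐) If a lies above some b ≥ a in the first stack, follow the run: a is eventually moved
--       by N; every later N moves a still smaller entry onto the second stack, and the first C
--       comes after an N with only E's in between, so the condition empties the first stack,
--       which still contains b.

open import Defs
open import Data.Nat using (ℕ; zero; suc; _+_; _∸_; _<_; _≤_; z≤n; s≤s)
open import Data.Nat.Properties using (+-suc; +-cancelʳ-≡; +-cancelˡ-≡; +-identityʳ; <-asym; <-irrefl; <-≤-trans; <⇒≤; _<?_; ≮⇒≥; m≤m+n)
open import Data.List using (List; []; _∷_; _++_; _∷ʳ_; length; take; drop; lookup)
open import Data.List.Properties using (∷-injective; ∷ʳ-++; ++-assoc; take++drop≡id; length-++; ++-identityʳ; ++-conicalˡ; ++-conicalʳ)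
open import Data.List.Relation.Unary.All using (All; []; _∷_)
import Data.List.Relation.Unary.All as All
import Data.List.Relation.Unary.All.Properties as All
open import Data.List.Relation.Unary.AllPairs using (AllPairs; []; _∷_)
import Data.List.Relation.Unary.AllPairs.Properties as AllPairs
open import Data.List.Membership.Propositional using (_∈_)
open import Data.List.Membership.Propositional.Properties using (∈-++⁺ˡ; ∈-++⁺ʳ)
open import Data.List.Relation.Unary.Any using (here; there)
import Data.List.Relation.Unary.Any as Any
open import Data.List.Relation.Unary.Any.Properties using (lookup-index; ¬Any[])
open import Data.List.Relation.Binary.Permutation.Propositional using (_↭_; ↭-refl; ↭-reflexive; ↭-sym; ↭-trans)
open import Data.List.Relation.Binary.Permutation.Propositional.Properties using (shift; ++⁺ˡ; All-resp-↭; ∈-resp-↭; ↭-length)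
open import Data.Maybe using (just; _>>=_)
open import Data.Product using (Σ; _×_; _,_; proj₁; proj₂)
open import Data.Sum using (_⊎_; inj₁; inj₂)
open import Data.Maybe.Properties using (just-injective)
open import Data.Empty using (⊥; ⊥-elim)
open import Relation.Nullary using (yes; no)
open import Function.Bundles using (_⇔_; mk⇔; Equivalence)
open import Data.Fin using (Fin)
open import Relation.Binary.PropositionalEquality using (_≡_; _≢_; refl; sym; trans; cong; subst)

private variable
  L : Letter
  A B V : Word
  c c' d : Config
  u : ℕ

snoc≡∷ʳ : ∀ (xs : List ℕ) x → snoc xs x ≡ xs ∷ʳ x
snoc≡∷ʳ []       x = refl
snoc≡∷ʳ (y ∷ xs) x = cong (y ∷_) (snoc≡∷ʳ xs x)

snoc-++ : ∀ (xs : List ℕ) x ys → snoc xs x ++ ys ≡ xs ++ x ∷ ys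
snoc-++ xs x ys = trans (cong (_++ ys) (snoc≡∷ʳ xs x)) (∷ʳ-++ xs x ys)

AllPairs-++⁻ : ∀ {R : ℕ → ℕ → Set} xs {ys} → AllPairs R (xs ++ ys) →
  AllPairs R xs × AllPairs R ys × All (λ x → All (R x) ys) xs
AllPairs-++⁻ []       p         = [] , p , []
AllPairs-++⁻ (x ∷ xs) (px ∷ p) with AllPairs-++⁻ xs p
... | pxs , pys , cross = All.++⁻ˡ xs px ∷ pxs , pys , All.++⁻ʳ xs px ∷ cross

length≡0⇒[] : ∀ (xs : List ℕ) → length xs ≡ 0 → xs ≡ []
length≡0⇒[] [] _ = refl

AllPairs-by-splits : ∀ {R : ℕ → ℕ → Set} xs → (∀ s a t b → xs ≡ s ++ a ∷ t → b ∈ t → R a b) → AllPairs R xs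
AllPairs-by-splits []       h = []
AllPairs-by-splits (x ∷ xs) h =
  All.tabulate (h [] x xs _ refl) ∷ AllPairs-by-splits xs (λ s a t b e → h (x ∷ s) a t b (cong (x ∷_) e))

run-∷ : run (L ∷ V) c ≡ just c' → Σ Config λ c₁ → step L c ≡ just c₁ × run V c₁ ≡ just c'
run-∷ {L} {c = c} h with step L c
... | just c₁ = c₁ , refl , h

run-++ : ∀ A → run A c ≡ just d → run (A ++ B) c ≡ run B d
run-++ []      refl = refl
run-++ {c = c} (L ∷ A) h with step L c
... | just c₁ = run-++ A h

run-preserves : (R : Config → Config → Set) → (∀ {c} → R c c) →
  (∀ {a b e} → R a b → R b e → R a e) →
  (∀ L {c c'} → step L c ≡ just c' → R c c') →
  ∀ V {c c'} → run V c ≡ just c' → R c c'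
run-preserves R refl′ trans′ step′ []      refl = refl′
run-preserves R refl′ trans′ step′ (L ∷ V) h with run-∷ {L = L} {V = V} h
... | c₁ , s , r = trans′ (step′ L s) (run-preserves R refl′ trans′ step′ V r)

step-E : step E c ≡ just c' → Σ ℕ λ x → stack1 c' ≡ x ∷ stack1 c × stack2 c' ≡ stack2 c
step-E {cfg (x ∷ i) s1 s2 o} refl = x , refl , refl
step-E {cfg [] _ _ _} ()

step-N : step N c ≡ just c' → Σ ℕ λ y → stack1 c ≡ y ∷ stack1 c' × stack2 c' ≡ y ∷ stack2 c
step-N {cfg i (y ∷ s1) s2 o} refl = y , refl , refl
step-N {cfg _ [] _ _} ()

step-C : step C c ≡ just c' → stack1 c' ≡ stack1 c × Σ ℕ λ x → stack2 c ≡ x ∷ stack2 c' × x ∈ output c'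
step-C {cfg i s1 (x ∷ s2) o} refl = refl , x , refl , subst (x ∈_) (sym (snoc≡∷ʳ o x)) (∈-++⁺ʳ o (here refl))
step-C {cfg _ _ [] _} ()

contents : Config → List ℕ
contents c = output c ++ stack2 c ++ stack1 c ++ input c

contents-run : ∀ V {c c'} → run V c ≡ just c' → contents c' ↭ contents c
contents-run = run-preserves (λ c c' → contents c' ↭ contents c) ↭-refl (λ p q → ↭-trans q p) step′
  where
  step′ : ∀ L {c c'} → step L c ≡ just c' → contents c' ↭ contents c
  step′ E {cfg (x ∷ i) s1 s2 o} refl = ++⁺ˡ o (++⁺ˡ s2 (↭-sym (shift x s1 i)))
  step′ N {cfg i (y ∷ s1) s2 o} refl = ++⁺ˡ o (↭-sym (shift y s2 (s1 ++ i)))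
  step′ C {cfg i s1 (x ∷ s2) o} refl = ↭-reflexive (snoc-++ o x (s2 ++ s1 ++ i))
  step′ E {cfg [] _ _ _} ()
  step′ N {cfg _ [] _ _} ()
  step′ C {cfg _ _ [] _} ()

Done : Config → Set
Done c = AllPairs _<_ (output c) × stack2 c ≡ [] × stack1 c ≡ [] × input c ≡ []

-- Invariant of every configuration from which the machine can still finish: the output
-- followed by the second stack is increasing, and every entry already output is smaller
-- than every entry of the first stack or the input.
Good : Config → Set
Good c = AllPairs _<_ (output c ++ stack2 c) × All (λ v → All (_< v) (output c)) (stack1 c ++ input c)

done-good : Done c → Good c
done-good {cfg .[] .[] .[] o} (sorted , refl , refl , refl) = subst (AllPairs _<_) (sym (++-identityʳ o)) sorted , []

good-run : ∀ V {c c'} → run V c ≡ just c' → Good c' → Good c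
good-run = run-preserves (λ c c' → Good c' → Good c) (λ g → g) (λ p q g → p (q g)) step′
  where
  step′ : ∀ L {c c'} → step L c ≡ just c' → Good c' → Good c
  step′ E {cfg (x ∷ i) s1 s2 o} refl (inc , below) = inc , All-resp-↭ (↭-sym (shift x s1 i)) below
  step′ N {cfg i (y ∷ s1) s2 o} refl (inc , below) with AllPairs-++⁻ o inc
  ... | po , (_ ∷ ps2) , cross = AllPairs.++⁺ po ps2 (All.map All.tail cross) , All.map All.head cross ∷ below
  step′ C {cfg i s1 (x ∷ s2) o} refl (inc , below) =
    subst (AllPairs _<_) (snoc-++ o x s2) inc ,
    All.map (λ p → All.++⁻ˡ o (subst (All _) (snoc≡∷ʳ o x) p)) below
  step′ E {cfg [] _ _ _} ()
  step′ N {cfg _ [] _ _} ()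
  step′ C {cfg _ _ [] _} ()

output-run : ∀ V {c c'} → run V c ≡ just c' → u ∈ output c → u ∈ output c'
output-run {u} = run-preserves (λ c c' → u ∈ output c → u ∈ output c') (λ m → m) (λ p q m → q (p m)) step′
  where
  step′ : ∀ L {c c'} → step L c ≡ just c' → u ∈ output c → u ∈ output c'
  step′ E {cfg (x ∷ i) s1 s2 o} refl m = m
  step′ N {cfg i (y ∷ s1) s2 o} refl m = m
  step′ C {cfg i s1 (x ∷ s2) o} refl m = subst (u ∈_) (sym (snoc≡∷ʳ o x)) (∈-++⁺ˡ m)
  step′ E {cfg [] _ _ _} ()
  step′ N {cfg _ [] _ _} ()
  step′ C {cfg _ _ [] _} ()

stack1-kept : ∀ V {c c'} → All (_≢ N) V → run V c ≡ just c' → u ∈ stack1 c → u ∈ stack1 c'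
stack1-kept []      _          refl m = m
stack1-kept (L ∷ V) (L≢N ∷ ≢N) h    m with run-∷ {L = L} {V = V} h
stack1-kept (E ∷ V) (_ ∷ ≢N)   _    m | _ , s , r with step-E s
... | x , s1 , _ = stack1-kept V ≢N r (subst (_ ∈_) (sym s1) (there m))
stack1-kept (N ∷ V) (N≢N ∷ _)  _    m | _ = ⊥-elim (N≢N refl)
stack1-kept (C ∷ V) (_ ∷ ≢N)   _    m | _ , s , r with step-C s
... | s1 , _ = stack1-kept V ≢N r (subst (_ ∈_) (sym s1) m)

stack1-count : ∀ V {c c'} → run V c ≡ just c' →
  length (stack1 c') + count N V ≡ length (stack1 c) + count E V
stack1-count []      refl = refl
stack1-count (E ∷ V) {cfg (x ∷ i) s1 s2 o} h = trans (stack1-count V h) (sym (+-suc (length s1) (count E V)))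
stack1-count (N ∷ V) {cfg i (y ∷ s1) s2 o} {c'} h =
  trans (+-suc (length (stack1 c')) (count N V)) (cong suc (stack1-count V h))
stack1-count (C ∷ V) {cfg i s1 (x ∷ s2) o} h = stack1-count V h
stack1-count (E ∷ V) {cfg [] _ _ _} ()
stack1-count (N ∷ V) {cfg _ [] _ _} ()
stack1-count (C ∷ V) {cfg _ _ [] _} ()

Balanced : Word → Set
Balanced A = count E A ≡ count N A

empty⇔balanced : ∀ π A {c} → run A (initial π) ≡ just c → stack1 c ≡ [] ⇔ Balanced A
empty⇔balanced π A {c} h = mk⇔ to from
  where
  count-A : length (stack1 c) + count N A ≡ count E A
  count-A = stack1-count A h
  to : stack1 c ≡ [] → Balanced A
  to e = sym (trans (cong (λ s → length s + count N A) (sym e)) count-A)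
  from : Balanced A → stack1 c ≡ []
  from b = length≡0⇒[] (stack1 c) (+-cancelʳ-≡ (count N A) (length (stack1 c)) 0 (trans count-A b))

letterAt-split : ∀ W x → letterAt W x ≡ just L →
  Σ Word λ P → Σ Word λ Q → W ≡ P ++ L ∷ Q × suc (length P) ≡ x
letterAt-split (M ∷ W) (suc zero)    refl = [] , W , refl , refl
letterAt-split (M ∷ W) (suc (suc x)) h with letterAt-split W (suc x) h
... | P , Q , refl , refl = M ∷ P , Q , refl , refl

letterAt-after : ∀ P L Q → letterAt (P ++ L ∷ Q) (suc (length P)) ≡ just L
letterAt-after []      L Q = refl
letterAt-after (p ∷ P) L Q = letterAt-after P L Q

take-prefix : ∀ (P Q : Word) → take (length P) (P ++ Q) ≡ P
take-prefix []      Q = refl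
take-prefix (p ∷ P) Q = cong (p ∷_) (take-prefix P Q)

take-prefix-∷ʳ : ∀ P L (Q : Word) → take (suc (length P)) (P ++ L ∷ Q) ≡ P ∷ʳ L
take-prefix-∷ʳ []      L Q = refl
take-prefix-∷ʳ (p ∷ P) L Q = cong (p ∷_) (take-prefix-∷ʳ P L Q)

split-compare : ∀ P L Q P' L' Q' → P ++ L ∷ Q ≡ P' ++ L' ∷ Q' →
  (Σ Word λ R → P' ≡ P ++ L ∷ R) ⊎ L ≡ L' ⊎ (Σ Word λ M → P ≡ P' ++ L' ∷ M)
split-compare []      L Q []       L' Q' refl = inj₂ (inj₁ refl)
split-compare []      L Q (p ∷ P') L' Q' refl = inj₁ (P' , refl)
split-compare (p ∷ P) L Q []       L' Q' refl = inj₂ (inj₂ (P , refl))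
split-compare (p ∷ P) L Q (p' ∷ P') L' Q' e with ∷-injective e
... | refl , e' with split-compare P L Q P' L' Q' e'
...   | inj₁ (R , refl)        = inj₁ (R , refl)
...   | inj₂ (inj₁ L≡L')       = inj₂ (inj₁ L≡L')
...   | inj₂ (inj₂ (M , refl)) = inj₂ (inj₂ (M , refl))

avoid-prefix : ∀ R T → All (_≢ L) R → ∀ k → k < length R → letterAt (R ++ T) (suc k) ≢ just L
avoid-prefix (r ∷ R) T (r≢L ∷ _)   zero    _         e = r≢L (just-injective e)
avoid-prefix (r ∷ R) T (_ ∷ ≢L)    (suc k) (s≤s k<R) e = avoid-prefix R T ≢L k k<R e

prefix-avoids : ∀ R T → (∀ k → k < length R → letterAt (R ++ T) (suc k) ≢ just L) → All (_≢ L) R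
prefix-avoids []      T h = []
prefix-avoids (r ∷ R) T h =
  (λ r≡L → h zero (s≤s z≤n) (cong just r≡L)) ∷ prefix-avoids R T (λ k k<R → h (suc k) (s≤s k<R))

Between : Word → Letter → Word → Word → Letter → Set
Between P M R T L = ∀ z → suc (length P) < z → z < suc (length (P ++ M ∷ R)) → letterAt (P ++ M ∷ R ++ T) z ≢ just L

avoid-between : ∀ P M R T → All (_≢ L) R → Between P M R T L
avoid-between []      M R T ≢L (suc (suc k)) _ (s≤s (s≤s k<R)) = avoid-prefix R T ≢L k k<R
avoid-between []      M R T ≢L (suc zero) (s≤s ()) _
avoid-between (p ∷ P) M R T ≢L (suc (suc z)) (s≤s lo@(s≤s _)) (s≤s hi) = avoid-between P M R T ≢L (suc z) lo hi

between-avoids : ∀ P M R T → Between P M R T L → All (_≢ L) R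
between-avoids []      M R T h = prefix-avoids R T (λ k k<R → h (suc (suc k)) (s≤s (s≤s z≤n)) (s≤s (s≤s k<R)))
between-avoids (p ∷ P) M R T h = between-avoids P M R T shifted
  where
  shifted : Between P M R T _
  shifted (suc z) lo hi = h (suc (suc z)) (s≤s lo) (s≤s hi)

run-between : ∀ A {B c d e} → run A c ≡ just d → run (A ++ B) c ≡ just e → run B d ≡ just e
run-between A r r' = trans (sym (run-++ A r)) r'

top-of : ∀ (f : Config → List ℕ) m {j} → (m >>= λ c → head? (f c)) ≡ just j →
  Σ Config λ c → m ≡ just c × Σ (List ℕ) λ s → f c ≡ j ∷ s
top-of f (just c) h with f c in eq
top-of f (just c) refl | x ∷ s = c , refl , s , eq

module FinishedRun (π : List ℕ) (W : Word) (cf : Config)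
                   (run-W : run W (initial π) ≡ just cf) (done : Done cf) where

  Reach : Word → Config → Set
  Reach A c = run A (initial π) ≡ just c

  Stagewise : (Config → Set) → Set
  Stagewise Q = ∀ {A V c} → W ≡ A ++ V → Reach A c → Q c

  finish : W ≡ A ++ V → Reach A c → run V c ≡ just cf
  finish {A} {V} eW r = run-between A r (subst (λ w → Reach w cf) eW run-W)

  good : Stagewise Good
  good {A} {V} eW r = good-run V (finish {A} eW r) (done-good done)

  stack2-increasing : Stagewise (λ c → AllPairs _<_ (stack2 c))
  stack2-increasing {A} {V} {c} eW r = proj₁ (proj₂ (AllPairs-++⁻ (output c) (proj₁ (good {A} {V} eW r))))

  output-below-stack1 : Stagewise (λ c → ∀ {u v} → u ∈ output c → v ∈ stack1 c → u < v)
  output-below-stack1 {A} {V} eW r u∈ v∈ = All.lookup (All.lookup (proj₂ (good {A} {V} eW r)) (∈-++⁺ˡ v∈)) u∈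

  stack1-empty-at-end : W ≡ A ++ [] → Reach A c → stack1 c ≡ []
  stack1-empty-at-end eW r with finish {V = []} eW r
  ... | refl = proj₁ (proj₂ (proj₂ done))

  next : W ≡ A ++ L ∷ V → Reach A c →
    Σ Config λ c' → step L c ≡ just c' × Reach (A ∷ʳ L) c' × W ≡ (A ∷ʳ L) ++ V
  next {A} {L} {V} eW r with run-∷ {L = L} {V = V} (finish eW r)
  ... | c' , s , _ = c' , s , trans (run-++ A r) (cong (_>>= run []) s) , trans eW (sym (∷ʳ-++ A L V))

  pop : ∀ {P Q c j s} → W ≡ P ++ N ∷ Q → Reach P c → stack1 c ≡ j ∷ s →
    Σ Config λ c' → Reach (P ∷ʳ N) c' × W ≡ (P ∷ʳ N) ++ Q × stack1 c' ≡ s × stack2 c' ≡ j ∷ stack2 c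
  pop eW r top with next eW r
  ... | c' , st , r' , eW' with step-N st
  ... | y , s1 , s2 with ∷-injective (trans (sym s1) top)
  ... | refl , rest = c' , r' , eW' , rest , s2

  output-top : ∀ {A V c j t} → W ≡ A ++ C ∷ V → Reach A c → stack2 c ≡ j ∷ t →
    Σ Config λ c' → Reach (A ∷ʳ C) c' × stack1 c' ≡ stack1 c × j ∈ output c'
  output-top eW r top with next eW r
  ... | c' , st , r' , _ with step-C st
  ... | s1 , x , s2 , x∈ with ∷-injective (trans (sym s2) top)
  ... | refl , _ = c' , r' , s1 , x∈

  stateAt-prefix : ∀ A V → W ≡ A ++ V → stateAt W π (length A) ≡ run A (initial π)
  stateAt-prefix A V eW = cong (λ w → run w (initial π)) (trans (cong (take (length A)) eW) (take-prefix A V))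

  stack1-in-π : Reach A c → u ∈ stack1 c → Σ (Fin (length π)) λ i → lookup π i ≡ u
  stack1-in-π {A} {c} {u} r u∈ = Any.index u∈π , sym (lookup-index u∈π)
    where
    u∈π : u ∈ π
    u∈π = ∈-resp-↭ (contents-run A r) (∈-++⁺ʳ (output c) (∈-++⁺ʳ (stack2 c) (∈-++⁺ˡ u∈)))

  occurrence : ∀ (f : Config → List ℕ) {P Q c j s} → W ≡ P ++ L ∷ Q → Reach P c → f c ≡ j ∷ s →
    letterAt W (suc (length P)) ≡ just L × (stateAt W π (length P) >>= λ c → head? (f c)) ≡ just j
  occurrence {L} f {P} {Q} eW r top =
    subst (λ w → letterAt w (suc (length P)) ≡ just L) (sym eW) (letterAt-after P L Q) ,
    trans (cong (_>>= λ c → head? (f c)) (trans (stateAt-prefix P (L ∷ Q) eW) r)) (cong head? top)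

  occurrence⁻¹ : ∀ (f : Config → List ℕ) x {j} → letterAt W x ≡ just L →
    (stateAt W π (x ∸ 1) >>= λ c → head? (f c)) ≡ just j →
    Σ Word λ P → Σ Word λ Q → W ≡ P ++ L ∷ Q × suc (length P) ≡ x ×
    Σ Config λ c → Reach P c × Σ (List ℕ) λ s → f c ≡ j ∷ s
  occurrence⁻¹ f x at top with letterAt-split W x at
  ... | P , Q , eW , refl with top-of f (stateAt W π (length P)) top
  ... | c , st , s , f-top = P , Q , eW , refl , c , trans (sym (stateAt-prefix P (_ ∷ Q) eW)) st , s , f-top

  rest-empty⇔balanced : ∀ {P Q c j s} → W ≡ P ++ N ∷ Q → Reach P c → stack1 c ≡ j ∷ s →
    s ≡ [] ⇔ Balanced (take (suc (length P)) W)
  rest-empty⇔balanced {P} {Q} eW r top with pop eW r top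
  ... | c' , r' , _ , rest , _ = mk⇔
    (λ e → subst Balanced (sym prefix) (Equivalence.to empty (trans rest e)))
    (λ b → trans (sym rest) (Equivalence.from empty (subst Balanced prefix b)))
    where
    empty : stack1 c' ≡ [] ⇔ Balanced (P ∷ʳ N)
    empty = empty⇔balanced π (P ∷ʳ N) r'
    prefix : take (suc (length P)) W ≡ P ∷ʳ N
    prefix = trans (cong (take (suc (length P))) eW) (take-prefix-∷ʳ P N Q)

  -- The condition of the lemma in split form: if N_j and C_j occur as W = (P N R) C S with
  -- no N in R, then N_j leaves the first stack empty.
  LoneNEmpties : Set
  LoneNEmpties = ∀ {P R S c j s d t} → W ≡ (P ++ N ∷ R) ++ C ∷ S → All (_≢ N) R →
    Reach P c → stack1 c ≡ j ∷ s → Reach (P ++ N ∷ R) d → stack2 d ≡ j ∷ t → s ≡ []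

  -- In a DI run such a C_j finds the first stack as N_j left it: an entry k < j left below j
  -- is still in the first stack when j is output, contradicting that the output stays below it.
  decreasing⇒lone : Stagewise (λ c → AllPairs _>_ (stack1 c)) → LoneNEmpties
  decreasing⇒lone dec {s = []} _ _ _ _ _ _ = refl
  decreasing⇒lone dec {P} {R} {S} {c} {j} {k ∷ s} {d} eW noN r top r-d top-d
    with pop (trans eW (++-assoc P (N ∷ R) (C ∷ S))) r top | output-top eW r-d top-d
  ... | _ , r₁ , _ , rest , _ | _ , r-d₁ , same-stack1 , j∈ = ⊥-elim (<-asym k<j j<k)
    where
    k<j : k < j
    k<j with subst (AllPairs _>_) top (dec {P} (trans eW (++-assoc P (N ∷ R) (C ∷ S))) r)
    ... | (k<j ∷ _) ∷ _ = k<j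
    k∈d : k ∈ stack1 d
    k∈d = stack1-kept R noN (run-between (P ∷ʳ N) r₁ (subst (λ A → Reach A d) (sym (∷ʳ-++ P N R)) r-d))
            (subst (k ∈_) (sym rest) (here refl))
    j<k : j < k
    j<k = output-below-stack1 {(P ++ N ∷ R) ∷ʳ C} {S} (trans eW (sym (∷ʳ-++ (P ++ N ∷ R) C S))) r-d₁ j∈
            (subst (k ∈_) (sym same-stack1) k∈d)

  -- The split form implies the condition stated by positions: a C_j before N_j is impossible,
  -- since an entry once output is smaller than everything still in the first stack.
  lone⇒condition : LoneNEmpties → Condition π W
  lone⇒condition lone i x y (atN , topN) (atC , topC) gap
    with occurrence⁻¹ stack1 x atN topN | occurrence⁻¹ stack2 y atC topC
  ... | P , Q , eW , refl , c , r , s , top | P' , Q' , eW' , refl , d , r-d , t , top-d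
    with split-compare P N Q P' C Q' (trans (sym eW) eW')
  ... | inj₁ (R , refl) = Equivalence.to (rest-empty⇔balanced eW r top) (lone eW' noN r top r-d top-d)
    where
    noN : All (_≢ N) R
    noN = between-avoids P N R (C ∷ Q') λ z lo hi at →
      gap z lo hi (subst (λ w → letterAt w z ≡ just N) (sym (trans eW' (++-assoc P (N ∷ R) (C ∷ Q')))) at)
  ... | inj₂ (inj₂ (M , refl)) with output-top eW' r-d top-d
  ...   | _ , r-d₁ , _ , j∈ =
    ⊥-elim (<-irrefl refl (output-below-stack1 {P' ++ C ∷ M} {N ∷ Q} eW r j∈c (subst (_ ∈_) (sym top) (here refl))))
    where
    j∈c : lookup π i ∈ output c
    j∈c = output-run M (run-between (P' ∷ʳ C) r-d₁ (subst (λ A → Reach A c) (sym (∷ʳ-++ P' C M)) r)) j∈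

  condition⇒lone : Condition π W → LoneNEmpties
  condition⇒lone cond {P} {R} {S} {j = j} eW noN r top r-d top-d
    with stack1-in-π {P} r (subst (j ∈_) (sym top) (here refl))
  ... | i , refl = Equivalence.from (rest-empty⇔balanced eW-N r top)
    (cond i (suc (length P)) (suc (length (P ++ N ∷ R)))
      (occurrence stack1 eW-N r top) (occurrence stack2 eW r-d top-d) gap)
    where
    eW-N : W ≡ P ++ N ∷ R ++ C ∷ S
    eW-N = trans eW (++-assoc P (N ∷ R) (C ∷ S))
    gap : ∀ z → suc (length P) < z → z < suc (length (P ++ N ∷ R)) → letterAt W z ≢ just N
    gap z lo hi at = avoid-between P N R (C ∷ S) noN z lo hi (subst (λ w → letterAt w z ≡ just N) eW-N at)

  -- Some N_j happened, followed so far
  -- only by letters other than N, so j is still on top of the second stack, and an entry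
  -- b ≥ j is left below.  The next C would be C_j and empty the first stack by the condition;
  -- the next N moves some y onto j, so y < j and y takes over the role of j; and the run
  -- cannot end with b in the first stack.
  after-pop : LoneNEmpties → ∀ V {P R c₀ j s c t b} → W ≡ (P ++ N ∷ R) ++ V → All (_≢ N) R →
    Reach P c₀ → stack1 c₀ ≡ j ∷ s → Reach (P ++ N ∷ R) c → stack2 c ≡ j ∷ t →
    b ∈ s → b ∈ stack1 c → j ≤ b → ⊥
  after-pop lone [] {P} {R} eW _ _ _ r _ _ b∈ _ =
    ¬Any[] (subst (_ ∈_) (stack1-empty-at-end {P ++ N ∷ R} eW r) b∈)
  after-pop lone (C ∷ V) eW noN r₀ top₀ r top b∈s _ _ = ¬Any[] (subst (_ ∈_) (lone eW noN r₀ top₀ r top) b∈s)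
  after-pop lone (E ∷ V) {P} {R} eW noN r₀ top₀ r top b∈s b∈ j≤b with next eW r
  ... | c' , st , r' , eW' with step-E st
  ... | x , s1 , s2 = after-pop lone V {P} {R ∷ʳ E} (trans eW' (cong (_++ V) assoc))
          (All.++⁺ noN ((λ ()) ∷ [])) r₀ top₀ (subst (λ A → Reach A c') assoc r') (trans s2 top)
          b∈s (subst (_ ∈_) (sym s1) (there b∈)) j≤b
    where
    assoc : (P ++ N ∷ R) ∷ʳ E ≡ P ++ N ∷ (R ∷ʳ E)
    assoc = ++-assoc P (N ∷ R) (E ∷ [])
  after-pop lone (N ∷ V) {P} {R} {b = b} eW noN r₀ top₀ r top b∈s b∈ j≤b with next eW r
  ... | c' , st , r' , eW' with step-N st
  ... | y , s1 , s2
    with subst (AllPairs _<_) (trans s2 (cong (y ∷_) top)) (stack2-increasing {(P ++ N ∷ R) ∷ʳ N} {V} eW' r')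
       | subst (b ∈_) s1 b∈
  ... | (y<j ∷ _) ∷ _ | here refl  = <-irrefl refl (<-≤-trans y<j j≤b)
  ... | (y<j ∷ _) ∷ _ | there b∈' =
    after-pop lone V {P ++ N ∷ R} {[]} eW' [] r s1 r' s2 b∈' b∈' (<⇒≤ (<-≤-trans y<j j≤b))

  -- First phase: an entry a lies above an entry b ≥ a in the first stack. Follow the run until
  -- a is moved by N; then the second phase applies with j = a.
  before-pop : LoneNEmpties → ∀ V {A c s a t b} → W ≡ A ++ V → Reach A c →
    stack1 c ≡ s ++ a ∷ t → b ∈ t → a ≤ b → ⊥
  before-pop lone [] {A} {s = s} {a} {t} eW r top _ _
    with ++-conicalʳ s (a ∷ t) (trans (sym top) (stack1-empty-at-end {A} eW r))
  ... | ()
  before-pop lone (E ∷ V) eW r top b∈ a≤b with next eW r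
  ... | c' , st , r' , eW' with step-E st
  ... | x , s1 , _ = before-pop lone V {s = x ∷ _} eW' r' (trans s1 (cong (x ∷_) top)) b∈ a≤b
  before-pop lone (C ∷ V) eW r top b∈ a≤b with next eW r
  ... | c' , st , r' , eW' with step-C st
  ... | s1 , _ = before-pop lone V eW' r' (trans s1 top) b∈ a≤b
  before-pop lone (N ∷ V) {A} {s = []} eW r top b∈ a≤b with pop eW r top
  ... | c' , r' , eW' , rest , s2 =
    after-pop lone V {A} {[]} eW' [] r top r' s2 b∈ (subst (_ ∈_) (sym rest) b∈) a≤b
  before-pop lone (N ∷ V) {s = x ∷ s} eW r top b∈ a≤b with pop eW r top
  ... | c' , r' , eW' , rest , _ = before-pop lone V eW' r' rest b∈ a≤b

  lone⇒DI : LoneNEmpties → Stagewise DIConfig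
  lone⇒DI lone {A} {V} {c} eW r = AllPairs-by-splits (stack1 c) decreasing , stack2-increasing {A} {V} eW r
    where
    decreasing : ∀ s a t b → stack1 c ≡ s ++ a ∷ t → b ∈ t → a > b
    decreasing s a t b top b∈ with b <? a
    ... | yes b<a = b<a
    ... | no  b≮a = ⊥-elim (before-pop lone V eW r top b∈ (≮⇒≥ b≮a))

  DIStages : Set
  DIStages = (k : ℕ) → k ≤ length W → (c : Config) → stateAt W π k ≡ just c → DIConfig c

  stagewise⇒DIStages : Stagewise DIConfig → DIStages
  stagewise⇒DIStages di k _ c r = di {take k W} {drop k W} (sym (take++drop≡id k W)) r

  DIStages⇒stagewise : DIStages → Stagewise DIConfig
  DIStages⇒stagewise di {A} {V} {c} eW r = di (length A) A≤W c (trans (stateAt-prefix A V eW) r)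
    where
    A≤W : length A ≤ length W
    A≤W = subst (length A ≤_) (sym (trans (cong length eW) (length-++ A))) (m≤m+n (length A) (length V))

-- A sorting word of a permutation of [n] ends with empty stacks and input: the machine only
-- permutes its entries, and the output already consists of all n of them.
sorting-run-done : ∀ n π → IsPerm n π → ∀ W {cf} → run W (initial π) ≡ just cf → output cf ≡ range n → Done cf
sorting-run-done n π perm W {cf} r out =
  subst (AllPairs _<_) (sym out) range-sorted ,
  ++-conicalˡ s2 _ empty , ++-conicalˡ s1 _ (++-conicalʳ s2 _ empty) , ++-conicalʳ s1 _ (++-conicalʳ s2 _ empty)
  where
  s2 s1 rest : List ℕ
  s2 = stack2 cf
  s1 = stack1 cf
  rest = s2 ++ s1 ++ input cf
  range-sorted : AllPairs _<_ (range n)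
  range-sorted = AllPairs.map⁺ (AllPairs.applyUpTo⁺₁ (λ i → i) n (λ i<j _ → s≤s i<j))
  all↭output : output cf ++ rest ↭ output cf
  all↭output = ↭-trans (contents-run W r) (↭-trans perm (↭-reflexive (sym out)))
  empty : rest ≡ []
  empty = length≡0⇒[] rest (+-cancelˡ-≡ (length (output cf)) (length rest) 0
    (trans (sym (length-++ (output cf))) (trans (↭-length all↭output) (sym (+-identityʳ _)))))

lemma2p9 : (n : ℕ) (π : List ℕ) → IsPerm n π → (W : Word) → SortingWord n π W →
    DIWord n π W ⇔ Condition π W
lemma2p9 n π perm W (cf , run-W , sorted) = mk⇔
  (λ (_ , di) → lone⇒condition (decreasing⇒lone λ {A} {V} eW r → proj₁ (DIStages⇒stagewise di {A} {V} eW r)))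
  (λ cond → (cf , run-W , sorted) , stagewise⇒DIStages λ {A} {V} → lone⇒DI (condition⇒lone cond) {A} {V})
  where open FinishedRun π W cf run-W (sorting-run-done n π perm W run-W sorted)
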